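{- Let $G=(V,E)$ be a finite graph, $v\in V$, and $c\ge 0$ an integer. Let $\mathcal A$ be a family of neighborhoods of $v$ in $G$, each of cut-size at most $c$. Then there is a cover $\mathcal B \subseteq \mathcal A$ of $\mathcal A$ with $|\mathcal B|\le (c+1)!$.
   Context: For $S \subseteq V$, $N(S)$ is the set of vertices not in $S$ adjacent to at least one vertex of $S$, and the cut-size of $S$ is $\eta(S)=|N(S)|$. A set $S\subseteq V$ is a neighborhood of $v$ if $v\in S$ and the subgraph induced by $S$ is connected. For a family $\mathcal A$ of vertex sets, a subfamily $\mathcal B\subseteq\mathcal A$ is a cover of $\mathcal A$ if every $T\in\mathcal A$ satisfies $T\subseteq\bigcup_{S\in\mathcal B}S$. -}

module Defs where

open import Data.Nat using (ℕ; zero; suc; _≤_)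
open import Data.Bool using (Bool; true; false; _∧_; not)
open import Data.Fin using (Fin)
open import Data.Fin.Subset using (Subset; _∈_; ∣_∣; _⊆_; _∪_; ⊥)
open import Data.Vec using (tabulate; lookup; toList)
open import Data.List using (List; foldr)
open import Data.Bool.ListAction using (or)
open import Data.List.Relation.Unary.All using (All)
open import Data.List.Relation.Unary.Any using (Any)
open import Data.Product using (_×_; ∃-syntax; Σ-syntax)
open import Relation.Binary.PropositionalEquality using (_≡_)

record Graph (n : ℕ) : Set where
  field
    adj      : Fin n → Fin n → Bool
    symmetric : ∀ u w → adj u w ≡ adj w u
    loopless  : ∀ u → adj u u ≡ false
open Graph public

Adj : ∀ {n} → Graph n → Fin n → Fin n → Set
Adj G u w = adj G u w ≡ true

data WalkIn {n} (G : Graph n) (S : Subset n) : Fin n → Fin n → Set where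
  here : ∀ {u} → u ∈ S → WalkIn G S u u
  step : ∀ {u w x} → u ∈ S → Adj G u w → WalkIn G S w x → WalkIn G S u x

-- The subgraph induced by S is connected (S nonempty is ensured by v ∈ S below).
InducedConnected : ∀ {n} → Graph n → Subset n → Set
InducedConnected G S = ∀ {u w} → u ∈ S → w ∈ S → WalkIn G S u w

IsNeighborhood : ∀ {n} → Graph n → Fin n → Subset n → Set
IsNeighborhood G v S = v ∈ S × InducedConnected G S

memb : ∀ {n} → Fin n → Subset n → Bool
memb u S = lookup S u

boundary : ∀ {n} → Graph n → Subset n → Subset n
boundary {n} G S = tabulate λ u →
  not (memb u S) ∧ or (toList (tabulate λ w → memb w S ∧ adj G w u))

cutSize : ∀ {n} → Graph n → Subset n → ℕ
cutSize G S = ∣ boundary G S ∣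

Covers : ∀ {n} → List (Subset n) → List (Subset n) → Set
Covers {n} B A = All (λ T → T ⊆ foldr _∪_ ⊥ B) A

-- Induction on c, for neighbourhoods of v in an induced subgraph G[W] with
-- cut-sizes measured in G[W]. Keep a largest member S₀. A member T ⊄ S₀ is
-- at most as large as S₀, so it misses a vertex of S₀, and a walk in S₀ from
-- v to that vertex leaves T: N(T) meets S₀. For c = 0 this forces T ⊆ S₀.
-- Otherwise every vertex of T outside S₀ lies in the component of T ∖ S₀
-- entered from some u ∈ N(S₀) ∩ W. That component is a neighbourhood of u in
-- G[W ∖ S₀] whose cut-size there is smaller than that of T in G[W], since
-- the vertices of N(T) ∩ S₀ no longer count. For each of the at most c + 1
-- vertices u the components are covered by those of at most (c + 1)!
-- members, so 1 + (c + 1)·(c + 1)! ≤ (c + 2)! members cover the family.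
module Submission where

open import Defs
open import Data.Bool using (Bool; true; false; _∧_; not)
import Data.Bool as Bool
open import Data.Bool.Properties using (∨-zeroʳ)
open import Data.Bool.ListAction using (or)
open import Data.Empty using (⊥; ⊥-elim)
open import Data.Fin using (Fin; zero; suc; _≟_)
open import Data.Fin.Properties using (any?)
open import Data.Fin.Subset using (Subset; ∣_∣; _⊆_; _⊂_; _∪_; _∩_; _─_; _-_; ⁅_⁆; ⊤)
  renaming (_∈_ to _∈ₛ_; _∉_ to _∉ₛ_; ⊥ to ∅)
open import Data.Fin.Subset.Properties
  using ( _∈?_; ∣p∣≤n; ∣⊥∣≡0; ∉⊥; ∈⊤; x∈⁅x⁆; p⊂q⇒∣p∣<∣q∣; x∈p∩q⁺; x∈p∩q⁻; x∈p∪q⁺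
        ; ∩-identityʳ; x∈p∧x∉q⇒x∈p─q; p─q⊆p; x∈p∧x≢y⇒x∈p-y; x∈p⇒∣p-x∣<∣p∣ )
open import Data.List using (List; []; _∷_; length; foldr; map; concatMap; filter)
open import Data.List.Extrema.Nat using (argmax; argmax-sel; f[⊥]≤f[argmax]; f[xs]≤f[argmax])
open import Data.List.Membership.Propositional using (_∈_; lose)
open import Data.List.Membership.Propositional.Properties
  using (∈-map⁺; ∈-filter⁺; ∈-filter⁻; ∈-concatMap⁺; ∈-concatMap⁻)
open import Data.List.Properties using (length-map; length-++)
open import Data.List.Relation.Binary.Subset.Propositional using () renaming (_⊆_ to _⊆ᴸ_)
open import Data.List.Relation.Unary.All as All using (All)
open import Data.List.Relation.Unary.Any as Any using (here; there)
open import Data.Nat using (ℕ; zero; suc; _≤_; _<_; _*_; _!; z≤n; s≤s)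
open import Data.Nat.Properties
  using (≤-trans; ≤-pred; <-≤-trans; <⇒≱; +-mono-≤; *-monoˡ-≤; ≤-reflexive; 1≤n!)
open import Data.Product using (∃-syntax; Σ-syntax; _×_; _,_; proj₁; proj₂)
open import Data.Sum using (_⊎_; inj₁; inj₂)
open import Data.Vec using (_∷_; lookup; tabulate; toList)
import Data.Vec as Vec
open import Data.Vec.Properties using ([]=⇒lookup; lookup⇒[]=; lookup∘tabulate)
open import Function using (_∘_)
open import Relation.Nullary using (Dec; yes; no; ¬?; does)
open import Relation.Nullary.Decidable using (_×-dec_; dec-true; decidable-stable)
open import Relation.Binary.PropositionalEquality using (_≡_; refl; sym; trans; cong; cong₂; subst)

private variable
  m : ℕ
  x y : Fin m
  p q : Subset m
  A B : Set

∉⇒lookup≡false : x ∉ₛ p → lookup p x ≡ false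
∉⇒lookup≡false {x = x} {p = p} x∉p with lookup p x in eq
... | true  = ⊥-elim (x∉p (lookup⇒[]= x p eq))
... | false = refl

lookup≡false⇒∉ : lookup p x ≡ false → x ∉ₛ p
lookup≡false⇒∉ px≡false x∈p with trans (sym ([]=⇒lookup x∈p)) px≡false
... | ()

∈-tabulate⁺ : {g : Fin m → Bool} → g x ≡ true → x ∈ₛ tabulate g
∈-tabulate⁺ {x = x} {g} gx = lookup⇒[]= x (tabulate g) (trans (lookup∘tabulate g x) gx)

∈-tabulate⁻ : {g : Fin m → Bool} → x ∈ₛ tabulate g → g x ≡ true
∈-tabulate⁻ {x = x} {g} x∈ = trans (sym (lookup∘tabulate g x)) ([]=⇒lookup x∈)

∧≡true⁻ : ∀ {a b} → a ∧ b ≡ true → a ≡ true × b ≡ true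
∧≡true⁻ {true} {true} _ = refl , refl

not≡true⁻ : ∀ {a} → not a ≡ true → a ≡ false
not≡true⁻ {false} _ = refl

or-tabulate⁺ : (g : Fin m → Bool) → g x ≡ true → or (toList (tabulate g)) ≡ true
or-tabulate⁺ {x = zero}  g gx rewrite gx = refl
or-tabulate⁺ {x = suc x} g gx rewrite or-tabulate⁺ (g ∘ suc) gx = ∨-zeroʳ (g zero)

or-tabulate⁻ : (g : Fin m → Bool) → or (toList (tabulate g)) ≡ true → ∃[ x ] g x ≡ true
or-tabulate⁻ {m = suc m} g h with g zero in g0
... | true  = zero , g0
... | false with or-tabulate⁻ (g ∘ suc) h
...   | x , gx = suc x , gx

x∈p─q⇒x∉q : x ∈ₛ p ─ q → x ∉ₛ q
x∈p─q⇒x∉q {p = _ ∷ p} {true  ∷ q} (Vec.there x∈) (Vec.there x∈q) = x∈p─q⇒x∉q x∈ x∈q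
x∈p─q⇒x∉q {p = _ ∷ p} {false ∷ q} (Vec.there x∈) (Vec.there x∈q) = x∈p─q⇒x∉q x∈ x∈q

x∈p─q⁻ : x ∈ₛ p ─ q → x ∈ₛ p × x ∉ₛ q
x∈p─q⁻ {p = p} {q} x∈ = p─q⊆p p q x∈ , x∈p─q⇒x∉q x∈

x∈p⇒∣p∣>0 : ∀ {m} {x : Fin m} {p : Subset m} → x ∈ₛ p → 0 < ∣ p ∣
x∈p⇒∣p∣>0 {m} {x} {p} x∈p =
  subst (_< ∣ p ∣) (∣⊥∣≡0 m) (p⊂q⇒∣p∣<∣q∣ ((λ x∈∅ → ⊥-elim (∉⊥ x∈∅)) , x , x∈p , ∉⊥))

∈-⋃⁺ : (Ss : List (Subset m)) {S : Subset m} → S ∈ Ss → x ∈ₛ S → x ∈ₛ foldr _∪_ ∅ Ss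
∈-⋃⁺ (_ ∷ Ss) (here refl) x∈ = x∈p∪q⁺ (inj₁ x∈)
∈-⋃⁺ (_ ∷ Ss) (there S∈) x∈ = x∈p∪q⁺ (inj₂ (∈-⋃⁺ Ss S∈ x∈))

elements : Subset m → List (Fin m)
elements Vec.[]       = []
elements (true  ∷ p) = zero ∷ map suc (elements p)
elements (false ∷ p) = map suc (elements p)

length-elements : (p : Subset m) → length (elements p) ≡ ∣ p ∣
length-elements Vec.[]       = refl
length-elements (true  ∷ p) = cong suc (trans (length-map suc (elements p)) (length-elements p))
length-elements (false ∷ p) = trans (length-map suc (elements p)) (length-elements p)

∈-elements : x ∈ₛ p → x ∈ elements p
∈-elements Vec.here = here refl
∈-elements {p = true  ∷ p} (Vec.there x∈) = there (∈-map⁺ suc (∈-elements x∈))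
∈-elements {p = false ∷ p} (Vec.there x∈) = ∈-map⁺ suc (∈-elements x∈)

largest : (g : A → ℕ) (a : A) (as : List A) →
          ∃[ b ] b ∈ a ∷ as × (∀ {a′} → a′ ∈ a ∷ as → g a′ ≤ g b)
largest g a as = argmax g a as , argmax∈ , maximal
  where
  argmax∈ : argmax g a as ∈ a ∷ as
  argmax∈ with argmax-sel g a as
  ... | inj₁ ≡a  = here ≡a
  ... | inj₂ ∈as = there ∈as
  maximal : ∀ {a′} → a′ ∈ a ∷ as → g a′ ≤ g (argmax g a as)
  maximal (here refl) = f[⊥]≤f[argmax] {f = g} a as
  maximal (there a′∈) = All.lookup (f[xs]≤f[argmax] a as) a′∈

length-concatMap≤ : ∀ {k} (g : A → List B) → (∀ a → length (g a) ≤ k) →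
                    (as : List A) → length (concatMap g as) ≤ length as * k
length-concatMap≤ g bound []       = z≤n
length-concatMap≤ g bound (a ∷ as) =
  ≤-trans (≤-reflexive (length-++ (g a))) (+-mono-≤ (bound a) (length-concatMap≤ g bound as))

record Cover (c : ℕ) {X : Set} (f : X → Subset m) (L : List X) : Set where
  field
    chosen  : List X
    chosen⊆ : chosen ⊆ᴸ L
    covers  : ∀ {x} → x ∈ L → ∀ {w} → w ∈ₛ f x → ∃[ y ] y ∈ chosen × w ∈ₛ f y
    bounded : length chosen ≤ suc c !
open Cover

module _ {n : ℕ} (G : Graph n) where

  private variable
    S T P W : Subset n
    a b u v w : Fin n

  source∈ : WalkIn G S a b → a ∈ₛ S
  source∈ (here a∈)     = a∈
  source∈ (step a∈ _ _) = a∈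

  target∈ : WalkIn G S a b → b ∈ₛ S
  target∈ (here b∈)       = b∈
  target∈ (step _ _ walk) = target∈ walk

  walk-mono : S ⊆ T → WalkIn G S a b → WalkIn G T a b
  walk-mono S⊆T (here a∈)        = here (S⊆T a∈)
  walk-mono S⊆T (step a∈ ab walk) = step (S⊆T a∈) ab (walk-mono S⊆T walk)

  walk-snoc : WalkIn G S a b → w ∈ₛ S → Adj G b w → WalkIn G S a w
  walk-snoc (here a∈)         w∈ bw = step a∈ bw (here w∈)
  walk-snoc (step a∈ ab walk) w∈ bw = step a∈ ab (walk-snoc walk w∈ bw)

  ∈-boundary⁺ : x ∉ₛ S → y ∈ₛ S → Adj G y x → x ∈ₛ boundary G S
  ∈-boundary⁺ {x = x} {S = S} x∉S y∈S yx = ∈-tabulate⁺ (cong₂ _∧_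
    (cong not (∉⇒lookup≡false x∉S))
    (or-tabulate⁺ (λ w → lookup S w ∧ adj G w x) (cong₂ _∧_ ([]=⇒lookup y∈S) yx)))

  ∈-boundary⁻ : x ∈ₛ boundary G S → x ∉ₛ S × ∃[ y ] y ∈ₛ S × Adj G y x
  ∈-boundary⁻ {S = S} x∈ with ∧≡true⁻ (∈-tabulate⁻ x∈)
  ... | x∉S , adjacent with or-tabulate⁻ _ adjacent
  ...   | y , y∈S∧yx with ∧≡true⁻ y∈S∧yx
  ...     | y∈S , yx = lookup≡false⇒∉ (not≡true⁻ x∉S) , y , lookup⇒[]= y S y∈S , yx

  split-at-last-visit : WalkIn G S a w → (u : Fin n) →
    WalkIn G (S - u) a w ⊎ (∃[ x ] Adj G u x × WalkIn G (S - u) x w) ⊎ u ≡ w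
  split-at-last-visit (here {a} a∈) u with a ≟ u
  ... | yes refl = inj₂ (inj₂ refl)
  ... | no a≢u   = inj₁ (here (x∈p∧x≢y⇒x∈p-y a∈ a≢u))
  split-at-last-visit (step {a} a∈ ax walk) u with split-at-last-visit walk u
  ... | inj₂ later = inj₂ later
  ... | inj₁ avoiding with a ≟ u
  ...   | yes refl = inj₂ (inj₁ (_ , ax , avoiding))
  ...   | no a≢u   = inj₁ (step (x∈p∧x≢y⇒x∈p-y a∈ a≢u) ax avoiding)

  -- Recursion on a bound k > ∣ S ∣; removing the start vertex u lowers ∣ S ∣.
  walkIn?′ : ∀ k S → ∣ S ∣ < k → ∀ u w → Dec (WalkIn G S u w)
  walkIn?′ (suc k) S (s≤s ∣S∣≤k) u w with u ∈? S
  ... | no u∉S = no (u∉S ∘ source∈)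
  ... | yes u∈S with u ≟ w
  ...   | yes refl = yes (here u∈S)
  ...   | no u≢w with any? (λ x → (adj G u x Bool.≟ true) ×-dec
                                  walkIn?′ k (S - u) (<-≤-trans (x∈p⇒∣p-x∣<∣p∣ u∈S) ∣S∣≤k) x w)
  ...     | yes (x , ux , walk) = yes (step u∈S ux (walk-mono (p─q⊆p S ⁅ u ⁆) walk))
  ...     | no none = no λ walk → excluded (split-at-last-visit walk u)
    where
    excluded : WalkIn G (S - u) u w ⊎ (∃[ x ] Adj G u x × WalkIn G (S - u) x w) ⊎ u ≡ w → ⊥
    excluded (inj₁ avoiding)       = x∈p─q⇒x∉q (source∈ avoiding) (x∈⁅x⁆ u)
    excluded (inj₂ (inj₁ re-exit)) = none re-exit
    excluded (inj₂ (inj₂ u≡w))     = u≢w u≡w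

  walkIn? : ∀ S u w → Dec (WalkIn G S u w)
  walkIn? S = walkIn?′ (suc n) S (s≤s (∣p∣≤n S))

  component : Subset n → Fin n → Subset n
  component S u = tabulate (λ w → does (walkIn? S u w))

  ∈-component⁺ : WalkIn G S u w → w ∈ₛ component S u
  ∈-component⁺ {S = S} {u = u} {w = w} walk = ∈-tabulate⁺ (dec-true (walkIn? S u w) walk)

  ∈-component⁻ : w ∈ₛ component S u → WalkIn G S u w
  ∈-component⁻ {w} {S} {u} w∈ with walkIn? S u w | ∈-tabulate⁻ {x = w} w∈
  ... | yes walk | _  = walk
  ... | no _     | ()

  component⊆ : component S u ⊆ S
  component⊆ {S = S} {u = u} = target∈ ∘ ∈-component⁻ {S = S} {u = u}

  walk-in-component : WalkIn G P u a → WalkIn G P a w → WalkIn G (component P u) a w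
  walk-in-component prefix (here a∈)     = here (∈-component⁺ prefix)
  walk-in-component prefix (step a∈ ab walk) =
    step (∈-component⁺ prefix) ab (walk-in-component (walk-snoc prefix (source∈ walk) ab) walk)

  Rooted : Subset n → Fin n → Set
  Rooted S r = ∀ {w} → w ∈ₛ S → WalkIn G S r w

  component-rooted : Rooted (component P u) u
  component-rooted w∈ = let walk = ∈-component⁻ w∈ in walk-in-component (here (source∈ walk)) walk

  boundary-component⊆ : boundary G (component P u) ⊆ boundary G P
  boundary-component⊆ {P = P} {u = u} {x = z} z∈N with ∈-boundary⁻ {S = component P u} z∈N
  ... | z∉C , y , y∈C , yz with z ∈? P
  ...   | yes z∈P =
    ⊥-elim (z∉C (∈-component⁺ (walk-snoc (∈-component⁻ {S = P} {u = u} y∈C) z∈P yz)))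
  ...   | no z∉P  = ∈-boundary⁺ {S = P} z∉P (component⊆ {S = P} {u = u} y∈C) yz

  boundary-─⊆ : x ∈ₛ boundary G (T ─ S) → x ∉ₛ S → x ∈ₛ boundary G T
  boundary-─⊆ {T = T} {S = S} x∈N x∉S with ∈-boundary⁻ {S = T ─ S} x∈N
  ... | x∉T─S , y , y∈T─S , yx =
    ∈-boundary⁺ (λ x∈T → x∉T─S (x∈p∧x∉q⇒x∈p─q x∈T x∉S)) (proj₁ (x∈p─q⁻ y∈T─S)) yx

  boundary-piece⊆ : boundary G (component (T ─ S) u) ∩ (W ─ S) ⊆ boundary G T ∩ W
  boundary-piece⊆ {T = T} {S = S} {u = u} {W = W} x∈
    with x∈p∩q⁻ (boundary G (component (T ─ S) u)) (W ─ S) x∈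
  ... | x∈N , x∈W─S with x∈p─q⁻ x∈W─S
  ...   | x∈W , x∉S =
    x∈p∩q⁺ (boundary-─⊆ {T = T} (boundary-component⊆ {P = T ─ S} {u = u} x∈N) x∉S , x∈W)

  walk-crosses-boundary : WalkIn G P a b → a ∈ₛ T → b ∉ₛ T → ∃[ z ] z ∈ₛ P × z ∈ₛ boundary G T
  walk-crosses-boundary (here _) a∈T b∉T = ⊥-elim (b∉T a∈T)
  walk-crosses-boundary {T = T} (step {w = y} _ ay walk) a∈T b∉T with y ∈? T
  ... | yes y∈T = walk-crosses-boundary walk y∈T b∉T
  ... | no y∉T  = y , source∈ walk , ∈-boundary⁺ y∉T a∈T ay

  final-segment-outside : WalkIn G T a w → w ∉ₛ S →
    (a ∉ₛ S × WalkIn G (T ─ S) a w) ⊎ (∃[ u ] u ∈ₛ boundary G S × WalkIn G (T ─ S) u w)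
  final-segment-outside (here a∈) w∉S = inj₁ (w∉S , here (x∈p∧x∉q⇒x∈p─q a∈ w∉S))
  final-segment-outside {S = S} (step {a} a∈ ay walk) w∉S with final-segment-outside walk w∉S
  ... | inj₂ entered = inj₂ entered
  ... | inj₁ (y∉S , outside) with a ∈? S
  ...   | yes a∈S = inj₂ (_ , ∈-boundary⁺ y∉S a∈S ay , outside)
  ...   | no a∉S  = inj₁ (a∉S , step (x∈p∧x∉q⇒x∈p─q a∈ a∉S) ay outside)

  enters-through-boundary : WalkIn G T a w → a ∈ₛ S → w ∉ₛ S →
                            ∃[ u ] u ∈ₛ boundary G S × WalkIn G (T ─ S) u w
  enters-through-boundary walk a∈S w∉S with final-segment-outside walk w∉S
  ... | inj₁ (a∉S , _) = ⊥-elim (a∉S a∈S)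
  ... | inj₂ entered   = entered

  boundary-meets : Rooted S v → v ∈ₛ T → ∣ T ∣ ≤ ∣ S ∣ → a ∈ₛ T → a ∉ₛ S →
                   ∃[ z ] z ∈ₛ S × z ∈ₛ boundary G T
  boundary-meets {S = S} {T = T} {a = a} rooted v∈T ∣T∣≤∣S∣ a∈T a∉S
    with any? (λ w → (w ∈? S) ×-dec ¬? (w ∈? T))
  ... | yes (w , w∈S , w∉T) = walk-crosses-boundary (rooted w∈S) v∈T w∉T
  ... | no S⊈T = ⊥-elim (<⇒≱ (p⊂q⇒∣p∣<∣q∣ (S⊆T , a , a∈T , a∉S)) ∣T∣≤∣S∣)
    where
    S⊆T : S ⊆ T
    S⊆T {w} w∈S = decidable-stable (w ∈? T) (λ w∉T → S⊈T (w , w∈S , w∉T))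

  record Admissible (c : ℕ) (W : Subset n) (v : Fin n) (S : Subset n) : Set where
    field
      within : S ⊆ W
      root∈  : v ∈ₛ S
      rooted : Rooted S v
      cut≤   : ∣ boundary G S ∩ W ∣ ≤ c
  open Admissible

  module LargestMember {c : ℕ} {W : Subset n} {v : Fin n} {X : Set}
    (f : X → Subset n) (L : List X) (adm : ∀ {x} → x ∈ L → Admissible (suc c) W v (f x))
    {m : X} (m∈L : m ∈ L) (largest : ∀ {x} → x ∈ L → ∣ f x ∣ ≤ ∣ f m ∣) where

    piece : Fin n → X → Subset n
    piece u x = component (f x ─ f m) u

    through : Fin n → List X
    through u = filter (λ x → u ∈? f x ─ f m) L

    piece-admissible : ∀ u {x} → x ∈ through u → Admissible c (W ─ f m) u (piece u x)
    piece-admissible u {x} x∈ with ∈-filter⁻ (λ x → u ∈? f x ─ f m) x∈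
    ... | x∈L , u∈ with x∈p─q⁻ u∈
    ...   | u∈x , u∉m
      with boundary-meets (rooted (adm m∈L)) (root∈ (adm x∈L)) (largest x∈L) u∈x u∉m
    ...     | z , z∈m , z∈N = record
      { within = λ w∈ → let w∈x , w∉m = x∈p─q⁻ (component⊆ {S = f x ─ f m} {u = u} w∈)
                         in x∈p∧x∉q⇒x∈p─q (within (adm x∈L) w∈x) w∉m
      ; root∈  = ∈-component⁺ (here u∈)
      ; rooted = component-rooted
      ; cut≤   = ≤-pred (≤-trans (p⊂q⇒∣p∣<∣q∣ shrinks) (cut≤ (adm x∈L)))
      }
      where
      z∉ : z ∉ₛ boundary G (piece u x) ∩ (W ─ f m)
      z∉ z∈ = x∈p─q⇒x∉q (proj₂ (x∈p∩q⁻ (boundary G (piece u x)) (W ─ f m) z∈)) z∈m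
      shrinks : boundary G (piece u x) ∩ (W ─ f m) ⊂ boundary G (f x) ∩ W
      shrinks = boundary-piece⊆ {T = f x} {S = f m} {u = u} {W = W}
              , z , x∈p∩q⁺ (z∈N , within (adm m∈L) z∈m) , z∉

    assemble : (∀ u → Cover c (piece u) (through u)) → Cover (suc c) f L
    assemble sub = record
      { chosen = m ∷ rest ; chosen⊆ = chosen⊆′ ; covers = covers′ ; bounded = bounded′ }
      where
      exits : List (Fin n)
      exits = elements (boundary G (f m) ∩ W)
      rest : List X
      rest = concatMap (chosen ∘ sub) exits

      chosen⊆′ : m ∷ rest ⊆ᴸ L
      chosen⊆′ (here refl) = m∈L
      chosen⊆′ (there y∈) with Any.satisfied (∈-concatMap⁻ (chosen ∘ sub) {xs = exits} y∈)
      ... | u , y∈u = proj₁ (∈-filter⁻ (λ x → u ∈? f x ─ f m) (chosen⊆ (sub u) y∈u))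

      covers′ : ∀ {x} → x ∈ L → ∀ {w} → w ∈ₛ f x → ∃[ y ] y ∈ m ∷ rest × w ∈ₛ f y
      covers′ x∈ {w} w∈ with w ∈? f m
      ... | yes w∈m = m , here refl , w∈m
      ... | no w∉m with enters-through-boundary (rooted (adm x∈) w∈) (root∈ (adm m∈L)) w∉m
      ...   | u , u∈N , walk
        with covers (sub u) (∈-filter⁺ (λ x → u ∈? f x ─ f m) x∈ (source∈ walk)) (∈-component⁺ walk)
      ...     | y , y∈ , w∈y =
        y , there (∈-concatMap⁺ (chosen ∘ sub) (lose u∈exits y∈))
          , proj₁ (x∈p─q⁻ (component⊆ {S = f y ─ f m} {u = u} w∈y))
        where
        u∈exits : u ∈ exits
        u∈exits = ∈-elements (x∈p∩q⁺ (u∈N , within (adm x∈) (proj₁ (x∈p─q⁻ (source∈ walk)))))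

      -- (c + 2)! = (c + 1)! + (c + 1)·(c + 1)!
      bounded′ : length (m ∷ rest) ≤ suc (suc c) !
      bounded′ = +-mono-≤ (1≤n! (suc c)) (≤-trans
        (length-concatMap≤ (chosen ∘ sub) (bounded ∘ sub) exits)
        (*-monoˡ-≤ (suc c !) (≤-trans (≤-reflexive (length-elements (boundary G (f m) ∩ W)))
                                      (cut≤ (adm m∈L)))))

  cover : (c : ℕ) {W : Subset n} {v : Fin n} {X : Set} (f : X → Subset n) (L : List X) →
          (∀ {x} → x ∈ L → Admissible c W v (f x)) → Cover c f L
  cover c f [] _ = record { chosen = [] ; chosen⊆ = λ () ; covers = λ () ; bounded = z≤n }
  cover zero f (x₀ ∷ L) adm with largest (∣_∣ ∘ f) x₀ L
  ... | m , m∈L , max = record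
    { chosen = m ∷ [] ; chosen⊆ = λ { (here refl) → m∈L } ; covers = covers′ ; bounded = s≤s z≤n }
    where
    covers′ : ∀ {x} → x ∈ x₀ ∷ L → ∀ {w} → w ∈ₛ f x → ∃[ y ] y ∈ m ∷ [] × w ∈ₛ f y
    covers′ x∈ {w} w∈ with w ∈? f m
    ... | yes w∈m = m , here refl , w∈m
    ... | no w∉m with boundary-meets (rooted (adm m∈L)) (root∈ (adm x∈)) (max x∈) w∈ w∉m
    ...   | z , z∈m , z∈N =
      ⊥-elim (<⇒≱ (x∈p⇒∣p∣>0 (x∈p∩q⁺ (z∈N , within (adm m∈L) z∈m))) (cut≤ (adm x∈)))
  cover (suc c) f (x₀ ∷ L) adm with largest (∣_∣ ∘ f) x₀ L
  ... | m , m∈L , max =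
    assemble (λ u → cover c (piece u) (through u) (piece-admissible u))
    where open LargestMember f (x₀ ∷ L) adm m∈L max

lemma8 : (n : ℕ) (G : Graph n) (v : Fin n) (c : ℕ) (𝒜 : List (Subset n)) →
         All (λ S → IsNeighborhood G v S × cutSize G S ≤ c) 𝒜 →
         Σ[ ℬ ∈ List (Subset n) ]
           (All (λ S → S ∈ 𝒜) ℬ × Covers ℬ 𝒜 × length ℬ ≤ (suc c) !)
lemma8 n G v c 𝒜 neighbourhoods =
  chosen ℬ , All.tabulate (chosen⊆ ℬ) , All.tabulate ⊆⋃ℬ , bounded ℬ
  where
  admissible : ∀ {S} → S ∈ 𝒜 → Admissible G c ⊤ v S
  admissible {S} S∈ with All.lookup neighbourhoods S∈
  ... | (v∈S , connected) , cut = record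
    { within = λ _ → ∈⊤
    ; root∈  = v∈S
    ; rooted = connected v∈S
    ; cut≤   = subst (_≤ c) (cong ∣_∣ (sym (∩-identityʳ (boundary G S)))) cut
    }
  ℬ : Cover c (λ S → S) 𝒜
  ℬ = cover G c (λ S → S) 𝒜 admissible
  ⊆⋃ℬ : ∀ {T} → T ∈ 𝒜 → T ⊆ foldr _∪_ ∅ (chosen ℬ)
  ⊆⋃ℬ T∈ w∈ with covers ℬ T∈ w∈
  ... | S , S∈ℬ , w∈S = ∈-⋃⁺ (chosen ℬ) S∈ℬ w∈S
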